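{- Let $G$ be a graph and $X,Y$ disjoint subsets of $V(G)$ such that $G$ is $X$–$Y$ normalized. Let $S\subseteq N(X)$ and assume that no vertex of $S$ is adjacent to a vertex of $Y$. Let $K_1$ be an important $X$–$Y$ separator of $G$ disjoint from $S$ and let $K(S)$ be the important witness of $S$. Then $NR(G,Y,K_1)\supseteq NR(G,Y,K(S))$ (i.e. $K_1\ge K(S)$).
   Context: All graphs are finite, simple and undirected. $G\setminus C$ is the subgraph induced by $V(G)\setminus C$; $N(C)=(\bigcup_{v\in C}N(v))\setminus C$. An $X$–$Y$ separator is a set $K\subseteq V(G)\setminus(X\cup Y)$ such that $G\setminus K$ has no path from $X$ to $Y$; minimal means inclusion-minimal, smallest means of minimum cardinality. $NR(G,A,B)$ is the set of vertices of $G\setminus B$ not reachable from $A$ in $G\setminus B$. $K'>K$ means $NR(G,Y,K')\supsetneq NR(G,Y,K)$. A minimal $X$–$Y$ separator $K$ is important if no $X$–$Y$ separator $K'$ satisfies $K'>K$ and $|K'|\le|K|$. The excess of an $X$–$Y$ separator $K$ is $|K|-r$, where $r$ is the minimum size of an $X$–$Y$ separator. $G$ is $X$–$Y$ normalized if $N(X)$ is the only smallest $X$–$Y$ separator. For $S\subseteq N(X)$ not adjacent to $Y$, the cover excess $CE(S)$ is the excess of a smallest $X$–$Y$ separator disjoint from $S$; a witness of $S$ is an $X$–$Y$ separator $K$ with $S\cap K=\emptyset$ and excess $CE(S)$; an important witness of $S$ is a witness that is an important $X$–$Y$ separator; there is exactly one, denoted $K(S)$. -}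

module Defs where

open import Data.Nat using (ℕ; zero; suc; _≤_; _∸_)
open import Data.Bool using (Bool; true; false; _∧_; _∨_; not)
open import Data.Fin using (Fin; zero; suc)
open import Data.Fin.Subset using (Subset; _∈_; _∉_; _⊆_; ∣_∣; inside; outside)
open import Data.Vec using (Vec; tabulate; lookup)
open import Data.Product using (Σ; ∃; _×_; _,_)
open import Relation.Nullary using (¬_)
open import Relation.Binary.PropositionalEquality using (_≡_)

record Graph (n : ℕ) : Set where
  field
    adj   : Fin n → Fin n → Bool
    sym   : ∀ u v → adj u v ≡ adj v u
    irrefl : ∀ v → adj v v ≡ false

open Graph public

Adjacent : ∀ {n} → Graph n → Fin n → Fin n → Set
Adjacent G u v = adj G u v ≡ true

anyFin : ∀ {n} → (Fin n → Bool) → Bool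
anyFin {zero}  f = false
anyFin {suc n} f = f zero ∨ anyFin (λ i → f (suc i))

Nbh : ∀ {n} → Graph n → Subset n → Subset n
Nbh G C = tabulate λ v → not (lookup C v) ∧ anyFin (λ u → lookup C u ∧ adj G u v)

Disjoint : ∀ {n} → Subset n → Subset n → Set
Disjoint A B = ∀ v → v ∈ A → v ∉ B

data Reach {n} (G : Graph n) (B A : Subset n) : Fin n → Set where
  start : ∀ {a} → a ∈ A → a ∉ B → Reach G B A a
  step  : ∀ {u v} → Reach G B A u → Adjacent G u v → v ∉ B → Reach G B A v

NR : ∀ {n} → Graph n → Subset n → Subset n → Fin n → Set
NR G A B v = v ∉ B × ¬ Reach G B A v

Separator : ∀ {n} → Graph n → Subset n → Subset n → Subset n → Set
Separator G X Y K =
  Disjoint K X × Disjoint K Y × (∀ y → y ∈ Y → ¬ Reach G K X y)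

MinimalSeparator : ∀ {n} → Graph n → Subset n → Subset n → Subset n → Set
MinimalSeparator G X Y K =
  Separator G X Y K × (∀ K' → K' ⊆ K → ¬ (K' ≡ K) → ¬ Separator G X Y K')

_,_,_⊢_>_ : ∀ {n} → Graph n → Subset n → Subset n → Subset n → Subset n → Set
G , X , Y ⊢ K' > K =
  (∀ v → NR G Y K v → NR G Y K' v) × ∃ λ v → NR G Y K' v × ¬ NR G Y K v

ImportantSeparator : ∀ {n} → Graph n → Subset n → Subset n → Subset n → Set
ImportantSeparator G X Y K =
  MinimalSeparator G X Y K ×
  (∀ K' → Separator G X Y K' → G , X , Y ⊢ K' > K → ¬ (∣ K' ∣ ≤ ∣ K ∣))

SmallestSepSize : ∀ {n} → Graph n → Subset n → Subset n → ℕ → Set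
SmallestSepSize G X Y r =
  (∃ λ K → Separator G X Y K × ∣ K ∣ ≡ r) ×
  (∀ K → Separator G X Y K → r ≤ ∣ K ∣)

Excess : ∀ {n} → Graph n → Subset n → Subset n → Subset n → ℕ → Set
Excess G X Y K e = ∃ λ r → SmallestSepSize G X Y r × e ≡ ∣ K ∣ ∸ r

Normalized : ∀ {n} → Graph n → Subset n → Subset n → Set
Normalized G X Y =
  ∃ λ r → SmallestSepSize G X Y r ×
    Separator G X Y (Nbh G X) × ∣ Nbh G X ∣ ≡ r ×
    (∀ K → Separator G X Y K → ∣ K ∣ ≡ r → K ≡ Nbh G X)

CoverExcess : ∀ {n} → Graph n → Subset n → Subset n → Subset n → ℕ → Set
CoverExcess G X Y S c =
  (∃ λ K → Separator G X Y K × Disjoint S K ×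
     (∀ K' → Separator G X Y K' → Disjoint S K' → ∣ K ∣ ≤ ∣ K' ∣) ×
     Excess G X Y K c)

Witness : ∀ {n} → Graph n → Subset n → Subset n → Subset n → Subset n → Set
Witness G X Y S K =
  Separator G X Y K × Disjoint S K ×
  ∃ λ c → CoverExcess G X Y S c × Excess G X Y K c

ImportantWitness : ∀ {n} → Graph n → Subset n → Subset n → Subset n → Subset n → Set
ImportantWitness G X Y S K = Witness G X Y S K × ImportantSeparator G X Y K

module Submission where

-- Write R(K) = NR(G,Y,K) for the region cut off from Y by a separator K;
-- it contains X, avoids Y, and its vertex boundary N(R(K)) lies inside K.
-- Suppose some v lies in R(K(S)) but not in R(K₁).  Put A = R(K(S)) and
-- B = R(K₁).  Both N(A ∪ B) and N(A ∩ B) are X–Y separators, and by the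
-- submodularity of the vertex boundary,
--   |N(A ∪ B)| + |N(A ∩ B)| ≤ |N(A)| + |N(B)| ≤ |K(S)| + |K₁|.
-- Now N(A ∪ B) > K₁ (its region contains B and also v), so importance of K₁
-- forces |N(A ∪ B)| > |K₁|; and N(A ∩ B) avoids S (since S ⊆ A ∩ B), so
-- minimality of the witness forces |N(A ∩ B)| ≥ |K(S)|: a contradiction.
--
-- Regions are predicates (reachability is inductive), so turning them into
-- subsets uses decidability, which holds up to double negation; this is
-- harmless because membership in a region is a negative statement.

open import Defs
open import Data.Nat using (ℕ; suc; _+_; _∸_; _≤_; _<_)
open import Data.Nat.Properties
  using (+-suc; +-comm; +-mono-≤; +-mono-<-≤; ≤-trans; ≤-antisym; ≤-reflexive; ≰⇒>; <-irrefl; <-≤-trans; ∸-cancelʳ-≡; module ≤-Reasoning)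
open import Data.Bool using (Bool; true; false; _∧_; not)
open import Data.Fin using (Fin; zero; suc)
open import Data.Fin.Subset using (Subset; _∈_; _∉_; _⊆_; ∣_∣; inside; outside; _∪_; _∩_)
open import Data.Fin.Subset.Properties
  using (_∈?_; p⊆q⇒∣p∣≤∣q∣; x∈p∪q⁺; x∈p∪q⁻; x∈p∩q⁺; x∈p∩q⁻)
open import Data.Vec using ([]; _∷_; tabulate; lookup)
open import Data.Vec.Properties using (lookup∘tabulate; []=⇒lookup; lookup⇒[]=)
open import Data.Product using (∃; _×_; _,_; proj₁; proj₂)
open import Data.Sum using (inj₁; inj₂)
open import Function using (_∘_)
open import Relation.Nullary using (¬_; Dec; yes; no; does)
open import Relation.Nullary.Negation using (contradiction; negated-stable)
open import Relation.Nullary.Decidable using (¬¬-excluded-middle)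
open import Relation.Binary.PropositionalEquality using (_≡_; refl; trans; cong; subst; module ≡-Reasoning) renaming (sym to ≡-sym)

module _ {n : ℕ} where

  ∈-tabulate⁻ : ∀ (f : Fin n → Bool) {v} → v ∈ tabulate f → f v ≡ true
  ∈-tabulate⁻ f {v} v∈ = trans (≡-sym (lookup∘tabulate f v)) ([]=⇒lookup v∈)

  ∈-tabulate⁺ : ∀ (f : Fin n → Bool) {v} → f v ≡ true → v ∈ tabulate f
  ∈-tabulate⁺ f {v} fv = lookup⇒[]= v (tabulate f) (trans (lookup∘tabulate f v) fv)

anyFin⁻ : ∀ {m} (f : Fin m → Bool) → anyFin f ≡ true → ∃ λ i → f i ≡ true
anyFin⁻ {suc m} f p with f zero in f0
... | true  = zero , f0
... | false = let (i , fi) = anyFin⁻ (f ∘ suc) p in suc i , fi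

anyFin⁺ : ∀ {m} (f : Fin m → Bool) i → f i ≡ true → anyFin f ≡ true
anyFin⁺ f zero    fi rewrite fi = refl
anyFin⁺ f (suc i) fi with f zero
... | true  = refl
... | false = anyFin⁺ (f ∘ suc) i fi

module _ {n : ℕ} (G : Graph n) where

  ∈Nbh⁻ : ∀ {P v} → v ∈ Nbh G P → v ∉ P × ∃ λ u → u ∈ P × Adjacent G u v
  ∈Nbh⁻ {P} {v} v∈N with lookup P v in Pv | ∈-tabulate⁻ _ v∈N
  ... | false | hasNeighbour =
    let (u , uP∧adj) = anyFin⁻ (λ u → lookup P u ∧ adj G u v) hasNeighbour
    in  (λ v∈P → contradiction (trans (≡-sym ([]=⇒lookup v∈P)) Pv) λ ())
      , u , member-and-adjacent uP∧adj
    where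
      member-and-adjacent : ∀ {u} → (lookup P u ∧ adj G u v) ≡ true → u ∈ P × Adjacent G u v
      member-and-adjacent {u} p with lookup P u in Pu
      ... | true = lookup⇒[]= u P Pu , p

  ∈Nbh⁺ : ∀ {P u v} → v ∉ P → u ∈ P → Adjacent G u v → v ∈ Nbh G P
  ∈Nbh⁺ {P} {u} {v} v∉P u∈P uv = ∈-tabulate⁺ _ (notP (anyFin⁺ _ u uP∧adj))
    where
      uP∧adj : (lookup P u ∧ adj G u v) ≡ true
      uP∧adj rewrite []=⇒lookup u∈P = uv
      notP : ∀ {b} → b ≡ true → (not (lookup P v) ∧ b) ≡ true
      notP b with lookup P v in Pv
      ... | true  = contradiction (lookup⇒[]= v P Pv) v∉P
      ... | false = b

  adjacent-sym : ∀ {u v} → Adjacent G u v → Adjacent G v u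
  adjacent-sym {u} {v} uv = trans (≡-sym (Graph.sym G u v)) uv

∣p∪q∣+∣p∩q∣≡∣p∣+∣q∣ : ∀ {n} (p q : Subset n) → ∣ p ∪ q ∣ + ∣ p ∩ q ∣ ≡ ∣ p ∣ + ∣ q ∣
∣p∪q∣+∣p∩q∣≡∣p∣+∣q∣ []            []            = refl
∣p∪q∣+∣p∩q∣≡∣p∣+∣q∣ (inside  ∷ p) (inside  ∷ q) = cong suc (begin
  ∣ p ∪ q ∣ + suc ∣ p ∩ q ∣  ≡⟨ +-suc ∣ p ∪ q ∣ ∣ p ∩ q ∣ ⟩
  suc (∣ p ∪ q ∣ + ∣ p ∩ q ∣) ≡⟨ cong suc (∣p∪q∣+∣p∩q∣≡∣p∣+∣q∣ p q) ⟩
  suc (∣ p ∣ + ∣ q ∣)         ≡⟨ ≡-sym (+-suc ∣ p ∣ ∣ q ∣) ⟩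
  ∣ p ∣ + suc ∣ q ∣          ∎)
  where open ≡-Reasoning
∣p∪q∣+∣p∩q∣≡∣p∣+∣q∣ (inside  ∷ p) (outside ∷ q) = cong suc (∣p∪q∣+∣p∩q∣≡∣p∣+∣q∣ p q)
∣p∪q∣+∣p∩q∣≡∣p∣+∣q∣ (outside ∷ p) (inside  ∷ q) =
  trans (cong suc (∣p∪q∣+∣p∩q∣≡∣p∣+∣q∣ p q)) (≡-sym (+-suc ∣ p ∣ ∣ q ∣))
∣p∪q∣+∣p∩q∣≡∣p∣+∣q∣ (outside ∷ p) (outside ∷ q) = ∣p∪q∣+∣p∩q∣≡∣p∣+∣q∣ p q

cover-card : ∀ {n} {C D K L : Subset n} →
  C ∪ D ⊆ K ∪ L → C ∩ D ⊆ K ∩ L → ∣ C ∣ + ∣ D ∣ ≤ ∣ K ∣ + ∣ L ∣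
cover-card {C = C} {D} {K} {L} ∪⊆ ∩⊆ = begin
  ∣ C ∣ + ∣ D ∣          ≡⟨ ≡-sym (∣p∪q∣+∣p∩q∣≡∣p∣+∣q∣ C D) ⟩
  ∣ C ∪ D ∣ + ∣ C ∩ D ∣  ≤⟨ +-mono-≤ (p⊆q⇒∣p∣≤∣q∣ ∪⊆) (p⊆q⇒∣p∣≤∣q∣ ∩⊆) ⟩
  ∣ K ∪ L ∣ + ∣ K ∩ L ∣  ≡⟨ ∣p∪q∣+∣p∩q∣≡∣p∣+∣q∣ K L ⟩
  ∣ K ∣ + ∣ L ∣          ∎
  where open ≤-Reasoning

module _ {n : ℕ} (G : Graph n) (A B : Subset n) where

  Nbh-∪ : Nbh G (A ∪ B) ⊆ Nbh G A ∪ Nbh G B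
  Nbh-∪ {w} w∈N with ∈Nbh⁻ G w∈N
  ... | w∉A∪B , u , u∈A∪B , uw with x∈p∪q⁻ A B u∈A∪B
  ... | inj₁ u∈A = x∈p∪q⁺ (inj₁ (∈Nbh⁺ G (w∉A∪B ∘ x∈p∪q⁺ ∘ inj₁) u∈A uw))
  ... | inj₂ u∈B = x∈p∪q⁺ (inj₂ (∈Nbh⁺ G (w∉A∪B ∘ x∈p∪q⁺ ∘ inj₂) u∈B uw))

  Nbh-∩ : Nbh G (A ∩ B) ⊆ Nbh G A ∪ Nbh G B
  Nbh-∩ {w} w∈N with ∈Nbh⁻ G w∈N
  ... | w∉A∩B , u , u∈A∩B , uw with x∈p∩q⁻ A B u∈A∩B | w ∈? A
  ... | u∈A , u∈B | yes w∈A =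
    x∈p∪q⁺ (inj₂ (∈Nbh⁺ G (λ w∈B → w∉A∩B (x∈p∩q⁺ (w∈A , w∈B))) u∈B uw))
  ... | u∈A , u∈B | no  w∉A = x∈p∪q⁺ (inj₁ (∈Nbh⁺ G w∉A u∈A uw))

  Nbh-∪∩ : Nbh G (A ∪ B) ∩ Nbh G (A ∩ B) ⊆ Nbh G A ∩ Nbh G B
  Nbh-∪∩ {w} w∈both with x∈p∩q⁻ (Nbh G (A ∪ B)) _ w∈both
  ... | w∈N∪ , w∈N∩ with ∈Nbh⁻ G w∈N∪ | ∈Nbh⁻ G w∈N∩
  ... | w∉A∪B , _ | _ , u , u∈A∩B , uw =
    let (u∈A , u∈B) = x∈p∩q⁻ A B u∈A∩B
    in  x∈p∩q⁺ ( ∈Nbh⁺ G (w∉A∪B ∘ x∈p∪q⁺ ∘ inj₁) u∈A uw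
               , ∈Nbh⁺ G (w∉A∪B ∘ x∈p∪q⁺ ∘ inj₂) u∈B uw)

  Nbh-submodular : ∣ Nbh G (A ∪ B) ∣ + ∣ Nbh G (A ∩ B) ∣ ≤ ∣ Nbh G A ∣ + ∣ Nbh G B ∣
  Nbh-submodular = cover-card cover∪ Nbh-∪∩
    where
      cover∪ : Nbh G (A ∪ B) ∪ Nbh G (A ∩ B) ⊆ Nbh G A ∪ Nbh G B
      cover∪ w∈ with x∈p∪q⁻ (Nbh G (A ∪ B)) _ w∈
      ... | inj₁ w∈N∪ = Nbh-∪ w∈N∪
      ... | inj₂ w∈N∩ = Nbh-∩ w∈N∩

_represents_ : ∀ {n} → Subset n → (Fin n → Set) → Set
A represents P = ∀ v → (v ∈ A → P v) × (P v → v ∈ A)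

¬¬-decidable : ∀ {n} (P : Fin n → Set) → ¬ ¬ (∀ v → Dec (P v))
¬¬-decidable {ℕ.zero} P k = k λ ()
¬¬-decidable {suc n}  P k = ¬¬-excluded-middle λ P0? →
  ¬¬-decidable (P ∘ suc) λ Psuc? → k λ { zero → P0? ; (suc v) → Psuc? v }

¬¬-representable : ∀ {n} (P : Fin n → Set) → ¬ ¬ (∃ λ A → A represents P)
¬¬-representable P k = ¬¬-decidable P λ P? →
  k (tabulate (does ∘ P?) , λ v → out (P? v) ∘ ∈-tabulate⁻ _ , ∈-tabulate⁺ _ ∘ into (P? v))
  where
    out : ∀ {Q : Set} (Q? : Dec Q) → does Q? ≡ true → Q
    out (yes q) _ = q
    into : ∀ {Q : Set} (Q? : Dec Q) → Q → does Q? ≡ true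
    into (yes _) _ = refl
    into (no ¬q) q = contradiction q ¬q

module _ {n : ℕ} (G : Graph n) where

  reach-avoids : ∀ {B A v} → Reach G B A v → v ∉ B
  reach-avoids (start _ v∉B)  = v∉B
  reach-avoids (step _ _ v∉B) = v∉B

  reach-reverse : ∀ {B A C v} → Reach G B A v → Reach G B C v →
    ∃ λ a → a ∈ A × Reach G B C a
  reach-reverse (start a∈A _) fromC = _ , a∈A , fromC
  reach-reverse (step r uv _) fromC =
    reach-reverse r (step fromC (adjacent-sym G uv) (reach-avoids r))

  -- Membership in a region is a negative statement, hence ¬¬-stable.
  NR-stable : ∀ {A B v} → ¬ ¬ NR G A B v → NR G A B v
  NR-stable ¬¬nr = (negated-stable λ k → ¬¬nr (k ∘ proj₁))
                 , (negated-stable λ k → ¬¬nr (k ∘ proj₂))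

module _ {n : ℕ} (G : Graph n) (X Y : Subset n) where

  reachable-in-region : ∀ {K v} → Separator G X Y K → Reach G K X v → NR G Y K v
  reachable-in-region (_ , _ , cut) fromX =
    reach-avoids G fromX , λ fromY →
      let (y , y∈Y , fromX') = reach-reverse G fromY fromX in cut y y∈Y fromX'

  separator-from-region : ∀ {K} → Disjoint K X → Disjoint K Y →
    (∀ x → x ∈ X → NR G Y K x) → Separator G X Y K
  separator-from-region K∩X K∩Y X⊆R =
    K∩X , K∩Y , λ y y∈Y fromX →
      let (x , x∈X , fromY) = reach-reverse G fromX (start y∈Y (reach-avoids G fromX))
      in  proj₂ (X⊆R x x∈X) fromY

  X-reached : ∀ {K x} → Separator G X Y K → x ∈ X → Reach G K X x
  X-reached sep x∈X = start x∈X (λ x∈K → proj₁ sep _ x∈K x∈X)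

  X-in-region : ∀ {K x} → Separator G X Y K → x ∈ X → NR G Y K x
  X-in-region sep x∈X = reachable-in-region sep (X-reached sep x∈X)

  Nbh-X-in-region : ∀ {K s} → Separator G X Y K → s ∈ Nbh G X → s ∉ K → NR G Y K s
  Nbh-X-in-region sep s∈N s∉K with ∈Nbh⁻ G s∈N
  ... | _ , x , x∈X , xs = reachable-in-region sep (step (X-reached sep x∈X) xs s∉K)

  region-avoids-Y : ∀ {K y} → y ∈ Y → ¬ NR G Y K y
  region-avoids-Y y∈Y (y∉K , unreached) = unreached (start y∈Y y∉K)

  region-boundary : ∀ {K A} → A represents NR G Y K → Nbh G A ⊆ K
  region-boundary {K} {A} R {w} w∈N with ∈Nbh⁻ G w∈N | w ∈? K
  ... | _ , _ | yes w∈K = w∈K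
  ... | w∉A , u , u∈A , uw | no w∉K =
    let (_ , unreached-u) = proj₁ (R u) u∈A
    in  contradiction (proj₂ (R w) (w∉K , λ fromY →
          unreached-u (step fromY (adjacent-sym G uw) (proj₁ (proj₁ (R u) u∈A))))) w∉A

  inside-own-region : ∀ {P} → (∀ y → y ∈ Y → y ∉ P) → ∀ v → v ∈ P → NR G Y (Nbh G P) v
  inside-own-region {P} Y∩P v v∈P = (λ v∈N → proj₁ (∈Nbh⁻ G v∈N) v∈P) , λ fromY → unreachable fromY v∈P
    where
      unreachable : ∀ {w} → Reach G (Nbh G P) Y w → w ∉ P
      unreachable (start y∈Y _)      = Y∩P _ y∈Y
      unreachable (step r uw _) w∈P = reach-avoids G r (∈Nbh⁺ G (unreachable r) w∈P (adjacent-sym G uw))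

  boundary-separator : ∀ {P} → X ⊆ P → (∀ y → y ∈ Y → y ∉ P) →
    (∀ y → y ∈ Y → y ∉ Nbh G P) → Separator G X Y (Nbh G P)
  boundary-separator X⊆P Y∩P Y∩N = separator-from-region
    (λ v v∈N v∈X → proj₁ (∈Nbh⁻ G v∈N) (X⊆P v∈X))
    (λ v v∈N v∈Y → Y∩N v v∈Y v∈N)
    (λ x x∈X → inside-own-region Y∩P x (X⊆P x∈X))

  Unimprovable : Subset n → Set
  Unimprovable K₁ = ∀ K' → Separator G X Y K' → G , X , Y ⊢ K' > K₁ → ¬ (∣ K' ∣ ≤ ∣ K₁ ∣)

  SmallestAvoiding : Subset n → Subset n → Set
  SmallestAvoiding S KS = ∀ K' → Separator G X Y K' → Disjoint S K' → ∣ KS ∣ ≤ ∣ K' ∣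

  uncross : ∀ {S K₁ KS A B} →
    Separator G X Y KS → SmallestAvoiding S KS →
    Separator G X Y K₁ → Unimprovable K₁ →
    A represents NR G Y KS → B represents NR G Y K₁ → S ⊆ A ∩ B →
    ∀ v → v ∈ A → ¬ ¬ (v ∈ B)
  uncross {S} {K₁} {KS} {A} {B} sepS smallestS sep₁ unimprovable₁ RA RB S⊆A∩B v v∈A v∉B =
    <-irrefl refl (<-≤-trans (+-mono-<-≤ K₁<N∪ KS≤N∩) N∪+N∩≤K₁+KS)
    where
      N∪ N∩ : Subset n
      N∪ = Nbh G (A ∪ B)
      N∩ = Nbh G (A ∩ B)

      avoidsY : ∀ {K C} → C represents NR G Y K → ∀ y → y ∈ Y → y ∉ C
      avoidsY RC y y∈Y y∈C = region-avoids-Y y∈Y (proj₁ (RC y) y∈C)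

      X⊆A : X ⊆ A
      X⊆A x∈X = proj₂ (RA _) (X-in-region sepS x∈X)

      N∪N⊆KS∪K₁ : Nbh G A ∪ Nbh G B ⊆ KS ∪ K₁
      N∪N⊆KS∪K₁ w∈ with x∈p∪q⁻ (Nbh G A) _ w∈
      ... | inj₁ w∈NA = x∈p∪q⁺ (inj₁ (region-boundary RA w∈NA))
      ... | inj₂ w∈NB = x∈p∪q⁺ (inj₂ (region-boundary RB w∈NB))

      boundary-avoids-Y : ∀ {C} → C ⊆ Nbh G A ∪ Nbh G B → ∀ y → y ∈ Y → y ∉ C
      boundary-avoids-Y C⊆ y y∈Y y∈C with x∈p∪q⁻ KS K₁ (N∪N⊆KS∪K₁ (C⊆ y∈C))
      ... | inj₁ y∈KS = proj₁ (proj₂ sepS) y y∈KS y∈Y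
      ... | inj₂ y∈K₁ = proj₁ (proj₂ sep₁) y y∈K₁ y∈Y

      Y∩A∪B : ∀ y → y ∈ Y → y ∉ A ∪ B
      Y∩A∪B y y∈Y y∈A∪B with x∈p∪q⁻ A B y∈A∪B
      ... | inj₁ y∈A = avoidsY RA y y∈Y y∈A
      ... | inj₂ y∈B = avoidsY RB y y∈Y y∈B

      sep∪ : Separator G X Y N∪
      sep∪ = boundary-separator (x∈p∪q⁺ ∘ inj₁ ∘ X⊆A) Y∩A∪B (boundary-avoids-Y (Nbh-∪ G A B))

      sep∩ : Separator G X Y N∩
      sep∩ = boundary-separator (λ x∈X → x∈p∩q⁺ (X⊆A x∈X , proj₂ (RB _) (X-in-region sep₁ x∈X)))
        (λ y y∈Y → avoidsY RA y y∈Y ∘ proj₁ ∘ x∈p∩q⁻ A B)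
        (boundary-avoids-Y (Nbh-∩ G A B))

      -- N(A ∪ B) improves on K₁: its region contains B, and also v.
      K₁<N∪ : ∣ K₁ ∣ < ∣ N∪ ∣
      K₁<N∪ = ≰⇒> (unimprovable₁ N∪ sep∪
        ( (λ w nr → inside-own-region Y∩A∪B w (x∈p∪q⁺ (inj₂ (proj₂ (RB w) nr))))
        , v , inside-own-region Y∩A∪B v (x∈p∪q⁺ (inj₁ v∈A)) , v∉B ∘ proj₂ (RB v)))

      -- N(A ∩ B) avoids S ⊆ A ∩ B, so it is no smaller than KS.
      KS≤N∩ : ∣ KS ∣ ≤ ∣ N∩ ∣
      KS≤N∩ = smallestS N∩ sep∩ λ s s∈S s∈N → proj₁ (∈Nbh⁻ G s∈N) (S⊆A∩B s∈S)

      N∪+N∩≤K₁+KS : ∣ N∪ ∣ + ∣ N∩ ∣ ≤ ∣ K₁ ∣ + ∣ KS ∣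
      N∪+N∩≤K₁+KS = begin
        ∣ N∪ ∣ + ∣ N∩ ∣                  ≤⟨ Nbh-submodular G A B ⟩
        ∣ Nbh G A ∣ + ∣ Nbh G B ∣        ≤⟨ +-mono-≤ (p⊆q⇒∣p∣≤∣q∣ (region-boundary RA))
                                                       (p⊆q⇒∣p∣≤∣q∣ (region-boundary RB)) ⟩
        ∣ KS ∣ + ∣ K₁ ∣                  ≡⟨ +-comm ∣ KS ∣ ∣ K₁ ∣ ⟩
        ∣ K₁ ∣ + ∣ KS ∣                  ∎
        where open ≤-Reasoning

  smallest-size-unique : ∀ {r r'} → SmallestSepSize G X Y r → SmallestSepSize G X Y r' → r ≡ r'
  smallest-size-unique ((K , sepK , ∣K∣≡r) , r-min) ((K' , sepK' , ∣K'∣≡r') , r'-min) =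
    ≤-antisym (≤-trans (r-min K' sepK') (≤-reflexive ∣K'∣≡r'))
              (≤-trans (r'-min K sepK) (≤-reflexive ∣K∣≡r))

  -- A witness of S has the excess, hence the size, of a smallest separator
  -- avoiding S.
  witness-smallest : ∀ {S KS} → Witness G X Y S KS → SmallestAvoiding S KS
  witness-smallest {KS = KS} (sepS , _ , c , (Km , sepKm , _ , Km-min , r' , r'-size , c≡∣Km∣∸r') , r , r-size , c≡∣KS∣∸r)
    K' sep' S∩K' = subst (_≤ ∣ K' ∣) (≡-sym ∣KS∣≡∣Km∣) (Km-min K' sep' S∩K')
    where
      open ≡-Reasoning
      ∣KS∣≡∣Km∣ : ∣ KS ∣ ≡ ∣ Km ∣
      ∣KS∣≡∣Km∣ = ∸-cancelʳ-≡ (proj₂ r-size KS sepS) (proj₂ r-size Km sepKm) (begin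
        ∣ KS ∣ ∸ r   ≡⟨ ≡-sym c≡∣KS∣∸r ⟩
        c            ≡⟨ c≡∣Km∣∸r' ⟩
        ∣ Km ∣ ∸ r'  ≡⟨ cong (∣ Km ∣ ∸_) (smallest-size-unique r'-size r-size) ⟩
        ∣ Km ∣ ∸ r   ∎)

lemma11 : ∀ {n} (G : Graph n) (X Y S K₁ KS : Subset n) →
    Disjoint X Y →
    Normalized G X Y →
    S ⊆ Nbh G X →
    (∀ s y → s ∈ S → y ∈ Y → ¬ Adjacent G s y) →
    ImportantSeparator G X Y K₁ → Disjoint S K₁ →
    ImportantWitness G X Y S KS →
    ∀ v → NR G Y KS v → NR G Y K₁ v
lemma11 G X Y S K₁ KS _ _ S⊆NX _ ((sep₁ , _) , unimprovable₁) S∩K₁ (witness@(sepS , S∩KS , _) , _) v v∈RS =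
  NR-stable G λ v∉R₁ →
  ¬¬-representable (NR G Y KS) λ (A , RA) →
  ¬¬-representable (NR G Y K₁) λ (B , RB) →
  let S⊆A∩B : S ⊆ A ∩ B
      S⊆A∩B {s} s∈S = x∈p∩q⁺
        ( proj₂ (RA s) (Nbh-X-in-region G X Y sepS (S⊆NX s∈S) (S∩KS s s∈S))
        , proj₂ (RB s) (Nbh-X-in-region G X Y sep₁ (S⊆NX s∈S) (S∩K₁ s s∈S)))
  in  uncross G X Y sepS (witness-smallest G X Y witness) sep₁ unimprovable₁ RA RB S⊆A∩B
        v (proj₂ (RA v) v∈RS) (v∉R₁ ∘ proj₁ (RB v))
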